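{- For every positive integer $n$, $$\sum_{j=1}^{n}\binom{n+j}{j}\binom{n}{j}(-1)^j\, j^2\Bigl(2\bigl(H^{(1)}_{n+j}-H^{(1)}_j\bigr)^2-\bigl(H^{(2)}_{n+j}-H^{(2)}_j\bigr)\Bigr)+\sum_{j=1}^{n}\binom{n+j}{j}^{ -1}\binom{n}{j}^{ -1}(-1)^j=n(2n-1)(-1)^n.$$
   Context: $H^{(i)}_m:=\sum_{k=1}^m k^{ -i}$ for $m\ge1$, and $H^{(i)}_0:=0$. -}

module Defs where

open import Data.Nat as ℕ using (ℕ; zero; suc)
open import Data.Integer using (ℤ; +_)
open import Data.Rational using (ℚ; 0ℚ; _/_; _+_; _*_; _-_; -_)

-- reciprocal of a natural number as a rational; convention inv 0 = 0
-- (only ever applied to positive integers below)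
inv : ℕ → ℚ
inv zero    = 0ℚ
inv (suc k) = + 1 / suc k

toℚ : ℕ → ℚ
toℚ m = + m / 1

sgn : ℕ → ℚ
sgn zero    = + 1 / 1
sgn (suc j) = - sgn j

sum1 : ℕ → (ℕ → ℚ) → ℚ
sum1 zero    f = 0ℚ
sum1 (suc m) f = sum1 m f + f (suc m)

H : ℕ → ℕ → ℚ
H i m = sum1 m (λ k → inv (k ℕ.^ i))

-- Write D f = Σ_{j=0}^n (-1)^j C(n,j) f(j) = (-1)^n Δ^n f(0) and u_k(j) = 1/(j+k), so that
-- H^{(i)}_{n+j} - H^{(i)}_j = Σ_{k=1}^n u_k(j)^i. As n!·C(n+j,j) = (j+1)⋯(j+n), D sends C(n+j,j)
-- to (-1)^n and kills the polynomial C(n+j,j)·u_k(j) of degree n-1 for 1 ≤ k ≤ n. Dividing it once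
-- more by j+k leaves a polynomial of degree < n plus the remainder (-1)^(k-1) (k-1)! (n-k)!/n! times
-- u_k, and D u_k = n! (k-1)!/(n+k)!; hence k² D(C(n+j,j) u_k²) = -(-1)^k/(C(n+k,k) C(n,k)).
-- Since j² u_k² = (1 - k u_k)² and, for k ≠ l, j² u_k u_l is 1 plus a combination of u_k and u_l,
-- D(C(n+j,j) j² u_k u_l) = (-1)^n - [k = l] (-1)^k/(C(n+k,k) C(n,k)); summing these with weights
-- 2 - [k = l] over 1 ≤ k, l ≤ n gives the theorem.
module Submission where

open import Defs
import Data.Integer as ℤ
import Data.Integer.Properties as ℤ
open import Data.Maybe using (Maybe; just; nothing)
open import Data.Nat as ℕ using (ℕ; zero; suc; NonZero; _!)
open import Data.Nat.Combinatorics using (_C_; nCk+nC[k+1]≡[n+1]C[k+1]; k>n⇒nCk≡0; nCk≡n!/k![n-k]!; k![n∸k]!∣n!)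
open import Data.Nat.DivMod using (m/n*n≡m)
import Data.Nat.Coprimality as Coprimality
import Data.Nat.Properties as ℕ
import Data.Nat.Tactic.RingSolver as ℕ-Solver
open import Data.Product using (_,_)
open import Data.Rational using (ℚ; mkℚ; 0ℚ; 1ℚ; _+_; _*_; _-_; -_; 1/_)
open import Data.Rational.Properties
  using ( +-*-commutativeRing; _≟_; toℚᵘ-injective; toℚᵘ-homo-+; toℚᵘ-homo-*; normalize-coprime; ↥p/↧p≡p
        ; +-identityˡ; +-identityʳ; +-inverseˡ; +-inverseʳ; +-assoc
        ; *-identityˡ; *-identityʳ; *-inverseˡ; *-zeroˡ; *-zeroʳ; *-assoc; *-comm
        ; *-distribˡ-+; *-distribʳ-+; neg-distribˡ-* )
import Data.Rational.Unnormalised as ℚᵘ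
import Data.Rational.Unnormalised.Properties as ℚᵘ
open import Function using (_∘_; const)
open import Level using (0ℓ)
open import Relation.Binary.PropositionalEquality
open import Relation.Nullary using (yes; no)
open import Tactic.RingSolver using (solve-∀)
open import Tactic.RingSolver.Core.AlmostCommutativeRing using (AlmostCommutativeRing; fromCommutativeRing)

ℚ-ring : AlmostCommutativeRing 0ℓ 0ℓ
ℚ-ring = fromCommutativeRing +-*-commutativeRing isZero
  where
  isZero : ∀ x → Maybe (0ℚ ≡ x)
  isZero x with 0ℚ ≟ x
  ... | yes 0≡x = just 0≡x
  ... | no _    = nothing

-- toℚ m = + m / 1 normalises through a gcd that does not reduce for a variable m, so the
-- homomorphism properties are proved for its normal form.
private
  embed : ℕ → ℚ
  embed m = mkℚ (ℤ.+ m) 0 (Coprimality.sym (Coprimality.1-coprimeTo m))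

  toℚ≡embed : ∀ m → toℚ m ≡ embed m
  toℚ≡embed m = normalize-coprime (Coprimality.sym (Coprimality.1-coprimeTo m))

  embed-+ : ∀ m n → embed (m ℕ.+ n) ≡ embed m + embed n
  embed-+ m n = toℚᵘ-injective (ℚᵘ.≃-trans (ℚᵘ.*≡* eq) (ℚᵘ.≃-sym (toℚᵘ-homo-+ (embed m) (embed n))))
    where
    eq : ℤ.+ (m ℕ.+ n) ℤ.* ℤ.+ 1 ≡ (ℤ.+ m ℤ.* ℤ.+ 1 ℤ.+ ℤ.+ n ℤ.* ℤ.+ 1) ℤ.* ℤ.+ 1
    eq rewrite ℤ.*-identityʳ (ℤ.+ m) | ℤ.*-identityʳ (ℤ.+ n) = cong (ℤ._* ℤ.+ 1) (ℤ.pos-+ m n)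

  embed-* : ∀ m n → embed (m ℕ.* n) ≡ embed m * embed n
  embed-* m n = toℚᵘ-injective (ℚᵘ.≃-trans (ℚᵘ.*≡* eq) (ℚᵘ.≃-sym (toℚᵘ-homo-* (embed m) (embed n))))
    where
    eq : ℤ.+ (m ℕ.* n) ℤ.* ℤ.+ 1 ≡ (ℤ.+ m ℤ.* ℤ.+ n) ℤ.* ℤ.+ 1
    eq = cong (ℤ._* ℤ.+ 1) (ℤ.pos-* m n)

toℚ-+ : ∀ m n → toℚ (m ℕ.+ n) ≡ toℚ m + toℚ n
toℚ-+ m n rewrite toℚ≡embed (m ℕ.+ n) | toℚ≡embed m | toℚ≡embed n = embed-+ m n

toℚ-* : ∀ m n → toℚ (m ℕ.* n) ≡ toℚ m * toℚ n
toℚ-* m n rewrite toℚ≡embed (m ℕ.* n) | toℚ≡embed m | toℚ≡embed n = embed-* m n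

toℚ-∸ : ∀ {k l} → k ℕ.≤ l → toℚ (l ℕ.∸ k) ≡ toℚ l - toℚ k
toℚ-∸ {k} {l} k≤l = begin
  toℚ (l ℕ.∸ k)                   ≡⟨ cancel (toℚ (l ℕ.∸ k)) (toℚ k) ⟨
  toℚ (l ℕ.∸ k) + toℚ k - toℚ k   ≡⟨ cong (_- toℚ k) (toℚ-+ (l ℕ.∸ k) k) ⟨
  toℚ (l ℕ.∸ k ℕ.+ k) - toℚ k     ≡⟨ cong (λ m → toℚ m - toℚ k) (ℕ.m∸n+n≡m k≤l) ⟩
  toℚ l - toℚ k                   ∎
  where
  open ≡-Reasoning
  cancel : ∀ x y → x + y - y ≡ x
  cancel = solve-∀ ℚ-ring

inv-inverseˡ : ∀ m .{{_ : NonZero m}} → inv m * toℚ m ≡ 1ℚ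
inv-inverseˡ (suc m) rewrite toℚ≡embed (suc m) =
  trans (cong (_* embed (suc m)) (↥p/↧p≡p (1/ embed (suc m)))) (*-inverseˡ (embed (suc m)))

inv-cancelˡ : ∀ m .{{_ : NonZero m}} x → inv m * (toℚ m * x) ≡ x
inv-cancelˡ m x = begin
  inv m * (toℚ m * x)  ≡⟨ *-assoc (inv m) (toℚ m) x ⟨
  inv m * toℚ m * x    ≡⟨ cong (_* x) (inv-inverseˡ m) ⟩
  1ℚ * x               ≡⟨ *-identityˡ x ⟩
  x                    ∎
  where open ≡-Reasoning

*-toℚ≡⇒≡inv* : ∀ m .{{_ : NonZero m}} {x y} → x * toℚ m ≡ y → x ≡ inv m * y
*-toℚ≡⇒≡inv* m {x} eq = trans (sym (inv-cancelˡ m x)) (cong (inv m *_) (trans (*-comm (toℚ m) x) eq))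

*-cancelʳ-toℚ : ∀ m .{{_ : NonZero m}} {x y} → x * toℚ m ≡ y * toℚ m → x ≡ y
*-cancelʳ-toℚ m {x} {y} eq =
  trans (*-toℚ≡⇒≡inv* m eq) (trans (cong (inv m *_) (*-comm y (toℚ m))) (inv-cancelˡ m y))

inv-^2 : ∀ m → inv (m ℕ.^ 2) ≡ inv m * inv m
inv-^2 zero    = refl
inv-^2 (suc m) = begin
  inv (s ℕ.^ 2)            ≡⟨ cong (λ x → inv (s ℕ.* x)) (ℕ.*-identityʳ s) ⟩
  inv (s ℕ.* s)            ≡⟨ *-identityʳ (inv (s ℕ.* s)) ⟨
  inv (s ℕ.* s) * 1ℚ       ≡⟨ *-toℚ≡⇒≡inv* (s ℕ.* s) inverse ⟨
  inv s * inv s            ∎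
  where
  open ≡-Reasoning
  s = suc m
  regroup : ∀ i x → i * i * (x * x) ≡ (i * x) * (i * x)
  regroup = solve-∀ ℚ-ring
  inverse : inv s * inv s * toℚ (s ℕ.* s) ≡ 1ℚ
  inverse = begin
    inv s * inv s * toℚ (s ℕ.* s)          ≡⟨ cong (inv s * inv s *_) (toℚ-* s s) ⟩
    inv s * inv s * (toℚ s * toℚ s)        ≡⟨ regroup (inv s) (toℚ s) ⟩
    (inv s * toℚ s) * (inv s * toℚ s)      ≡⟨ cong₂ _*_ (inv-inverseˡ s) (inv-inverseˡ s) ⟩
    1ℚ                                     ∎

sum1-cong : ∀ n {f g} → f ≗ g → sum1 n f ≡ sum1 n g
sum1-cong zero    f≗g = refl
sum1-cong (suc n) f≗g = cong₂ _+_ (sum1-cong n f≗g) (f≗g (suc n))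

sum1-- : ∀ n f g → sum1 n (λ j → f j - g j) ≡ sum1 n f - sum1 n g
sum1-- zero    f g = sym (+-inverseʳ 0ℚ)
sum1-- (suc n) f g = trans (cong (_+ (f (suc n) - g (suc n))) (sum1-- n f g))
                           (interchange (sum1 n f) (sum1 n g) (f (suc n)) (g (suc n)))
  where
  interchange : ∀ a b c e → (a - b) + (c - e) ≡ (a + c) - (b + e)
  interchange = solve-∀ ℚ-ring

sum1-front : ∀ n f → sum1 (suc n) f ≡ f 1 + sum1 n (f ∘ suc)
sum1-front zero    f = trans (+-identityˡ (f 1)) (sym (+-identityʳ (f 1)))
sum1-front (suc n) f = trans (cong (_+ f (suc (suc n))) (sum1-front n f)) (+-assoc (f 1) _ _)

sum1-difference : ∀ n j f → sum1 (n ℕ.+ j) f - sum1 j f ≡ sum1 n (λ k → f (j ℕ.+ k))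
sum1-difference zero    j f = +-inverseʳ (sum1 j f)
sum1-difference (suc n) j f = begin
  sum1 (n ℕ.+ j) f + f (suc (n ℕ.+ j)) - sum1 j f    ≡⟨ swap (sum1 (n ℕ.+ j) f) (f (suc (n ℕ.+ j))) (sum1 j f) ⟩
  sum1 (n ℕ.+ j) f - sum1 j f + f (suc (n ℕ.+ j))    ≡⟨ cong₂ _+_ (sum1-difference n j f) (cong f (ℕ.+-comm (suc n) j)) ⟩
  sum1 n (λ k → f (j ℕ.+ k)) + f (j ℕ.+ suc n)       ∎
  where
  open ≡-Reasoning
  swap : ∀ s x t → s + x - t ≡ s - t + x
  swap = solve-∀ ℚ-ring

nCk*k![n∸k]!≡n! : ∀ {n k} → k ℕ.≤ n → (n C k) ℕ.* (k ! ℕ.* (n ℕ.∸ k) !) ≡ n !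
nCk*k![n∸k]!≡n! {n} {k} k≤n =
  trans (cong (ℕ._* (k ! ℕ.* (n ℕ.∸ k) !)) (nCk≡n!/k![n-k]! k≤n))
        (m/n*n≡m {{k ℕ.!* (n ℕ.∸ k) !≢0}} (k![n∸k]!∣n! k≤n))

nCk≢0 : ∀ {n k} → k ℕ.≤ n → NonZero (n C k)
nCk≢0 {n} {k} k≤n = ℕ.≢-nonZero λ nCk≡0 →
  ℕ.≢-nonZero⁻¹ (n !) {{n ℕ.!≢0}} (trans (sym (nCk*k![n∸k]!≡n! k≤n)) (cong (ℕ._* (k ! ℕ.* (n ℕ.∸ k) !)) nCk≡0))

inv-nCk : ∀ {n k} → k ℕ.≤ n → inv (n C k) * toℚ (n !) ≡ toℚ (k ! ℕ.* (n ℕ.∸ k) !)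
inv-nCk {n} {k} k≤n = begin
  inv (n C k) * toℚ (n !)                                   ≡⟨ cong (λ m → inv (n C k) * toℚ m) (nCk*k![n∸k]!≡n! k≤n) ⟨
  inv (n C k) * toℚ ((n C k) ℕ.* (k ! ℕ.* (n ℕ.∸ k) !))     ≡⟨ cong (inv (n C k) *_) (toℚ-* (n C k) _) ⟩
  inv (n C k) * (toℚ (n C k) * toℚ (k ! ℕ.* (n ℕ.∸ k) !))   ≡⟨ inv-cancelˡ (n C k) {{nCk≢0 k≤n}} _ ⟩
  toℚ (k ! ℕ.* (n ℕ.∸ k) !)                                 ∎
  where open ≡-Reasoning

Δ : (ℕ → ℚ) → ℕ → ℚ
Δ f j = f (suc j) - f j

Δ^ : ℕ → (ℕ → ℚ) → ℕ → ℚ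
Δ^ zero    f = f
Δ^ (suc d) f = Δ^ d (Δ f)

Δ^-cong : ∀ d {f g} → f ≗ g → Δ^ d f ≗ Δ^ d g
Δ^-cong zero    f≗g = f≗g
Δ^-cong (suc d) f≗g = Δ^-cong d (λ j → cong₂ _-_ (f≗g (suc j)) (f≗g j))

Δ^-+ : ∀ d f g → Δ^ d (λ j → f j + g j) ≗ λ j → Δ^ d f j + Δ^ d g j
Δ^-+ zero    f g j = refl
Δ^-+ (suc d) f g j =
  trans (Δ^-cong d (λ i → interchange (f (suc i)) (g (suc i)) (f i) (g i)) j) (Δ^-+ d (Δ f) (Δ g) j)
  where
  interchange : ∀ a b c e → (a + b) - (c + e) ≡ (a - c) + (b - e)
  interchange = solve-∀ ℚ-ring

Δ^-- : ∀ d f g → Δ^ d (λ j → f j - g j) ≗ λ j → Δ^ d f j - Δ^ d g j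
Δ^-- zero    f g j = refl
Δ^-- (suc d) f g j =
  trans (Δ^-cong d (λ i → interchange (f (suc i)) (g (suc i)) (f i) (g i)) j) (Δ^-- d (Δ f) (Δ g) j)
  where
  interchange : ∀ a b c e → (a - b) - (c - e) ≡ (a - c) - (b - e)
  interchange = solve-∀ ℚ-ring

Δ^-* : ∀ d c f → Δ^ d (λ j → c * f j) ≗ λ j → c * Δ^ d f j
Δ^-* zero    c f j = refl
Δ^-* (suc d) c f j =
  trans (Δ^-cong d (λ i → factor c (f (suc i)) (f i)) j) (Δ^-* d c (Δ f) j)
  where
  factor : ∀ c a b → c * a - c * b ≡ c * (a - b)
  factor = solve-∀ ℚ-ring

Δ^-shift : ∀ d f → Δ^ d (f ∘ suc) ≗ Δ^ d f ∘ suc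
Δ^-shift zero    f j = refl
Δ^-shift (suc d) f j = Δ^-shift d (Δ f) j

Δ^-suc : ∀ d f → Δ^ (suc d) f ≗ Δ (Δ^ d f)
Δ^-suc d f j = trans (Δ^-- d (f ∘ suc) f j) (cong (_- Δ^ d f j) (Δ^-shift d f j))

Δ^-+const : ∀ d f c → Δ^ (suc d) (λ j → f j + c) ≗ Δ^ (suc d) f
Δ^-+const d f c = Δ^-cong d (λ j → cancel (f (suc j)) (f j) c)
  where
  cancel : ∀ a b c → (a + c) - (b + c) ≡ a - b
  cancel = solve-∀ ℚ-ring

Δ^-raise : ∀ d {f v} → Δ^ d f ≗ const v → Δ^ (suc d) f ≗ const 0ℚ
Δ^-raise d {f} {v} Δ^f≗v j = begin
  Δ^ (suc d) f j                ≡⟨ Δ^-suc d f j ⟩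
  Δ^ d f (suc j) - Δ^ d f j     ≡⟨ cong₂ _-_ (Δ^f≗v (suc j)) (Δ^f≗v j) ⟩
  v - v                         ≡⟨ +-inverseʳ v ⟩
  0ℚ                            ∎
  where open ≡-Reasoning

Δ-*-linear : ∀ s f j → Δ (λ i → f i * (toℚ i + s)) j ≡ Δ f j * (toℚ j + s) + f (suc j)
Δ-*-linear s f j = begin
  f (suc j) * (toℚ (suc j) + s) - f j * (toℚ j + s)  ≡⟨ cong (λ x → f (suc j) * (x + s) - f j * (toℚ j + s)) (toℚ-+ 1 j) ⟩
  f (suc j) * ((1ℚ + toℚ j) + s) - f j * (toℚ j + s) ≡⟨ expand (f (suc j)) (f j) (toℚ j) s ⟩
  (f (suc j) - f j) * (toℚ j + s) + f (suc j)        ∎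
  where
  open ≡-Reasoning
  expand : ∀ a b x s → a * ((1ℚ + x) + s) - b * (x + s) ≡ (a - b) * (x + s) + a
  expand = solve-∀ ℚ-ring

Δ^-*-linear : ∀ d s {f v} → Δ^ d f ≗ const v →
              Δ^ (suc d) (λ j → f j * (toℚ j + s)) ≗ const (toℚ (suc d) * v)
Δ^-*-linear zero s {f} {v} f≗v j = begin
  Δ (λ i → f i * (toℚ i + s)) j                ≡⟨ Δ-*-linear s f j ⟩
  (f (suc j) - f j) * (toℚ j + s) + f (suc j)  ≡⟨ cong₂ (λ a b → (a - b) * (toℚ j + s) + a) (f≗v (suc j)) (f≗v j) ⟩
  (v - v) * (toℚ j + s) + v                    ≡⟨ collapse v (toℚ j + s) ⟩
  1ℚ * v                                       ∎
  where
  open ≡-Reasoning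
  collapse : ∀ v x → (v - v) * x + v ≡ 1ℚ * v
  collapse = solve-∀ ℚ-ring
Δ^-*-linear (suc d) s {f} {v} Δ^f≗v j = begin
  Δ^ (suc d) (Δ (λ i → f i * (toℚ i + s))) j
    ≡⟨ Δ^-cong (suc d) (Δ-*-linear s f) j ⟩
  Δ^ (suc d) (λ i → Δ f i * (toℚ i + s) + f (suc i)) j
    ≡⟨ Δ^-+ (suc d) (λ i → Δ f i * (toℚ i + s)) (f ∘ suc) j ⟩
  Δ^ (suc d) (λ i → Δ f i * (toℚ i + s)) j + Δ^ (suc d) (f ∘ suc) j
    ≡⟨ cong₂ _+_ (Δ^-*-linear d s Δ^f≗v j) (trans (Δ^-shift (suc d) f j) (Δ^f≗v (suc j))) ⟩
  toℚ (suc d) * v + v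
    ≡⟨ collect (toℚ (suc d)) v ⟩
  (1ℚ + toℚ (suc d)) * v
    ≡⟨ cong (_* v) (toℚ-+ 1 (suc d)) ⟨
  toℚ (suc (suc d)) * v
    ∎
  where
  open ≡-Reasoning
  collect : ∀ m v → m * v + v ≡ (1ℚ + m) * v
  collect = solve-∀ ℚ-ring

Δ^-*-linear-+const : ∀ d s c {q} → Δ^ d q ≗ const 0ℚ →
                     Δ^ (suc d) (λ j → q j * (toℚ j + s) + c) ≗ const 0ℚ
Δ^-*-linear-+const d s c {q} Δ^q≗0 j =
  trans (Δ^-+const d (λ i → q i * (toℚ i + s)) c j)
        (trans (Δ^-*-linear d s Δ^q≗0 j) (*-zeroʳ (toℚ (suc d))))

altSum : ℕ → (ℕ → ℚ) → ℚ
altSum n f = sgn n * Δ^ n f 0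

altSum-cong : ∀ n {f g} → f ≗ g → altSum n f ≡ altSum n g
altSum-cong n f≗g = cong (sgn n *_) (Δ^-cong n f≗g 0)

altSum-+ : ∀ n f g → altSum n (λ j → f j + g j) ≡ altSum n f + altSum n g
altSum-+ n f g = trans (cong (sgn n *_) (Δ^-+ n f g 0)) (*-distribˡ-+ (sgn n) _ _)

altSum-* : ∀ n c f → altSum n (λ j → c * f j) ≡ c * altSum n f
altSum-* n c f = trans (cong (sgn n *_) (Δ^-* n c f 0)) (swap (sgn n) c (Δ^ n f 0))
  where
  swap : ∀ s c x → s * (c * x) ≡ c * (s * x)
  swap = solve-∀ ℚ-ring

altSum-poly : ∀ n {f v} → Δ^ n f ≗ const v → altSum n f ≡ sgn n * v
altSum-poly n Δ^f≗v = cong (sgn n *_) (Δ^f≗v 0)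

altSum-suc : ∀ n f → altSum (suc n) f ≡ altSum n f - altSum n (f ∘ suc)
altSum-suc n f = begin
  - sgn n * Δ^ (suc n) f 0                         ≡⟨ cong (- sgn n *_) (Δ^-suc n f 0) ⟩
  - sgn n * (Δ^ n f 1 - Δ^ n f 0)                  ≡⟨ expand (sgn n) (Δ^ n f 1) (Δ^ n f 0) ⟩
  sgn n * Δ^ n f 0 - sgn n * Δ^ n f 1              ≡⟨ cong (λ x → altSum n f - sgn n * x) (Δ^-shift n f 0) ⟨
  altSum n f - altSum n (f ∘ suc)                  ∎
  where
  open ≡-Reasoning
  expand : ∀ s a b → - s * (a - b) ≡ s * b - s * a
  expand = solve-∀ ℚ-ring

signedBinomSum : ℕ → (ℕ → ℚ) → ℚ
signedBinomSum n f = sum1 n (λ j → sgn j * toℚ (n C j) * f j)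

signedBinomSum-suc : ∀ n f → signedBinomSum (suc n) f ≡ signedBinomSum n f - (f 1 + signedBinomSum n (f ∘ suc))
signedBinomSum-suc n f = begin
  sum1 (suc n) h
    ≡⟨ sum1-front n h ⟩
  h 1 + sum1 n (h ∘ suc)
    ≡⟨ cong₂ _+_ (pascal 0) (trans (sum1-cong n pascal) (sum1-- n (k ∘ suc) k′)) ⟩
  (k 1 - k′ 0) + (sum1 n (k ∘ suc) - sum1 n k′)
    ≡⟨ regroup (k 1) (sum1 n (k ∘ suc)) (k′ 0) (sum1 n k′) ⟩
  (k 1 + sum1 n (k ∘ suc)) - (k′ 0 + sum1 n k′)
    ≡⟨ cong₂ (λ x y → x - (y + sum1 n k′)) (sym (sum1-front n k)) (*-identityˡ (f 1)) ⟩
  sum1 n k + k (suc n) - (f 1 + sum1 n k′)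
    ≡⟨ cong (λ x → sum1 n k + x - (f 1 + sum1 n k′)) k[1+n]≡0 ⟩
  sum1 n k + 0ℚ - (f 1 + sum1 n k′)
    ≡⟨ cong (_- (f 1 + sum1 n k′)) (+-identityʳ (sum1 n k)) ⟩
  sum1 n k - (f 1 + sum1 n k′)
    ∎
  where
  open ≡-Reasoning
  k k′ h : ℕ → ℚ
  k  j = sgn j * toℚ (n C j) * f j
  k′ j = sgn j * toℚ (n C j) * f (suc j)
  h  j = sgn j * toℚ (suc n C j) * f j
  k[1+n]≡0 : k (suc n) ≡ 0ℚ
  k[1+n]≡0 = trans (cong (λ c → sgn (suc n) * toℚ c * f (suc n)) (k>n⇒nCk≡0 (ℕ.n<1+n n)))
                   (trans (cong (_* f (suc n)) (*-zeroʳ (sgn (suc n)))) (*-zeroˡ (f (suc n))))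
  split : ∀ s a b x → - s * (a + b) * x ≡ - s * b * x - s * a * x
  split = solve-∀ ℚ-ring
  pascal : ∀ j → h (suc j) ≡ k (suc j) - k′ j
  pascal j = begin
    - sgn j * toℚ (suc n C suc j) * f (suc j)
      ≡⟨ cong (λ c → - sgn j * toℚ c * f (suc j)) (nCk+nC[k+1]≡[n+1]C[k+1] n j) ⟨
    - sgn j * toℚ (n C j ℕ.+ n C suc j) * f (suc j)
      ≡⟨ cong (λ c → - sgn j * c * f (suc j)) (toℚ-+ (n C j) (n C suc j)) ⟩
    - sgn j * (toℚ (n C j) + toℚ (n C suc j)) * f (suc j)
      ≡⟨ split (sgn j) (toℚ (n C j)) (toℚ (n C suc j)) (f (suc j)) ⟩
    k (suc j) - k′ j
      ∎
  regroup : ∀ a b c d → (a - c) + (b - d) ≡ (a + b) - (c + d)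
  regroup = solve-∀ ℚ-ring

altSum-expand : ∀ n f → altSum n f ≡ f 0 + signedBinomSum n f
altSum-expand zero    f = trans (*-identityˡ (f 0)) (sym (+-identityʳ (f 0)))
altSum-expand (suc n) f = begin
  altSum (suc n) f
    ≡⟨ altSum-suc n f ⟩
  altSum n f - altSum n (f ∘ suc)
    ≡⟨ cong₂ _-_ (altSum-expand n f) (altSum-expand n (f ∘ suc)) ⟩
  (f 0 + signedBinomSum n f) - (f 1 + signedBinomSum n (f ∘ suc))
    ≡⟨ +-assoc (f 0) (signedBinomSum n f) (- (f 1 + signedBinomSum n (f ∘ suc))) ⟩
  f 0 + (signedBinomSum n f - (f 1 + signedBinomSum n (f ∘ suc)))
    ≡⟨ cong (f 0 +_) (signedBinomSum-suc n f) ⟨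
  f 0 + signedBinomSum (suc n) f
    ∎
  where open ≡-Reasoning

rising : ℚ → ℕ → ℚ
rising x zero    = 1ℚ
rising x (suc m) = rising x m * (x + toℚ (suc m))

rising-+ : ∀ x m n → rising x (m ℕ.+ n) ≡ rising x m * rising (x + toℚ m) n
rising-+ x m zero = trans (cong (rising x) (ℕ.+-identityʳ m)) (sym (*-identityʳ (rising x m)))
rising-+ x m (suc n) = begin
  rising x (m ℕ.+ suc n)
    ≡⟨ cong (rising x) (ℕ.+-suc m n) ⟩
  rising x (m ℕ.+ n) * (x + toℚ (suc (m ℕ.+ n)))
    ≡⟨ cong₂ (λ r t → r * (x + t)) (rising-+ x m n) (trans (cong toℚ (sym (ℕ.+-suc m n))) (toℚ-+ m (suc n))) ⟩
  rising x m * rising (x + toℚ m) n * (x + (toℚ m + toℚ (suc n)))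
    ≡⟨ regroup (rising x m) (rising (x + toℚ m) n) x (toℚ m) (toℚ (suc n)) ⟩
  rising x m * (rising (x + toℚ m) n * (x + toℚ m + toℚ (suc n)))
    ∎
  where
  open ≡-Reasoning
  regroup : ∀ a b x y z → a * b * (x + (y + z)) ≡ a * (b * (x + y + z))
  regroup = solve-∀ ℚ-ring

rising-zero : ∀ n → rising 0ℚ n ≡ toℚ (n !)
rising-zero zero    = refl
rising-zero (suc n) = begin
  rising 0ℚ n * (0ℚ + toℚ (suc n)) ≡⟨ cong₂ _*_ (rising-zero n) (+-identityˡ (toℚ (suc n))) ⟩
  toℚ (n !) * toℚ (suc n)          ≡⟨ *-comm (toℚ (n !)) (toℚ (suc n)) ⟩
  toℚ (suc n) * toℚ (n !)          ≡⟨ toℚ-* (suc n) (n !) ⟨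
  toℚ (suc n !)                    ∎
  where open ≡-Reasoning

rising-neg : ∀ n → rising (- toℚ (suc n)) n ≡ sgn n * toℚ (n !)
rising-neg zero    = refl
rising-neg (suc n) = begin
  rising (- toℚ (2 ℕ.+ n)) (1 ℕ.+ n)
    ≡⟨ rising-+ (- toℚ (2 ℕ.+ n)) 1 n ⟩
  rising (- toℚ (2 ℕ.+ n)) 1 * rising (- toℚ (2 ℕ.+ n) + 1ℚ) n
    ≡⟨ cong (λ t → 1ℚ * (- t + 1ℚ) * rising (- t + 1ℚ) n) (toℚ-+ 1 (suc n)) ⟩
  1ℚ * (- (1ℚ + toℚ (suc n)) + 1ℚ) * rising (- (1ℚ + toℚ (suc n)) + 1ℚ) n
    ≡⟨ cong₂ _*_ (step (toℚ (suc n))) (cong (λ t → rising t n) (step′ (toℚ (suc n)))) ⟩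
  - toℚ (suc n) * rising (- toℚ (suc n)) n
    ≡⟨ cong (- toℚ (suc n) *_) (rising-neg n) ⟩
  - toℚ (suc n) * (sgn n * toℚ (n !))
    ≡⟨ swap (toℚ (suc n)) (sgn n) (toℚ (n !)) ⟩
  - sgn n * (toℚ (suc n) * toℚ (n !))
    ≡⟨ cong (- sgn n *_) (toℚ-* (suc n) (n !)) ⟨
  - sgn n * toℚ (suc n !)
    ∎
  where
  open ≡-Reasoning
  step : ∀ t → 1ℚ * (- (1ℚ + t) + 1ℚ) ≡ - t
  step = solve-∀ ℚ-ring
  step′ : ∀ t → - (1ℚ + t) + 1ℚ ≡ - t
  step′ = solve-∀ ℚ-ring
  swap : ∀ a s f → - a * (s * f) ≡ - s * (a * f)
  swap = solve-∀ ℚ-ring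

rising-! : ∀ j n → rising (toℚ j) n * toℚ (j !) ≡ toℚ ((n ℕ.+ j) !)
rising-! j zero    = *-identityˡ (toℚ (j !))
rising-! j (suc n) = begin
  rising (toℚ j) n * (toℚ j + toℚ (suc n)) * toℚ (j !)
    ≡⟨ swap (rising (toℚ j) n) (toℚ j + toℚ (suc n)) (toℚ (j !)) ⟩
  (toℚ j + toℚ (suc n)) * (rising (toℚ j) n * toℚ (j !))
    ≡⟨ cong₂ _*_ (sym (toℚ-+ j (suc n))) (rising-! j n) ⟩
  toℚ (j ℕ.+ suc n) * toℚ ((n ℕ.+ j) !)
    ≡⟨ cong (λ m → toℚ m * toℚ ((n ℕ.+ j) !)) (trans (ℕ.+-suc j n) (cong suc (ℕ.+-comm j n))) ⟩
  toℚ (suc n ℕ.+ j) * toℚ ((n ℕ.+ j) !)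
    ≡⟨ toℚ-* (suc n ℕ.+ j) ((n ℕ.+ j) !) ⟨
  toℚ ((suc n ℕ.+ j) !)
    ∎
  where
  open ≡-Reasoning
  swap : ∀ r x f → r * x * f ≡ x * (r * f)
  swap = solve-∀ ℚ-ring

binomial-rising : ∀ n j → toℚ ((n ℕ.+ j) C j) * toℚ (n !) ≡ rising (toℚ j) n
binomial-rising n j = *-cancelʳ-toℚ (j !) {{j ℕ.!≢0}} (begin
  toℚ ((n ℕ.+ j) C j) * toℚ (n !) * toℚ (j !)
    ≡⟨ *-assoc (toℚ ((n ℕ.+ j) C j)) (toℚ (n !)) (toℚ (j !)) ⟩
  toℚ ((n ℕ.+ j) C j) * (toℚ (n !) * toℚ (j !))
    ≡⟨ cong (toℚ ((n ℕ.+ j) C j) *_) (*-comm (toℚ (n !)) (toℚ (j !))) ⟩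
  toℚ ((n ℕ.+ j) C j) * (toℚ (j !) * toℚ (n !))
    ≡⟨ trans (toℚ-* ((n ℕ.+ j) C j) (j ! ℕ.* n !)) (cong (toℚ ((n ℕ.+ j) C j) *_) (toℚ-* (j !) (n !))) ⟨
  toℚ (((n ℕ.+ j) C j) ℕ.* (j ! ℕ.* n !))
    ≡⟨ cong (λ m → toℚ (((n ℕ.+ j) C j) ℕ.* (j ! ℕ.* m !))) (ℕ.m+n∸n≡m n j) ⟨
  toℚ (((n ℕ.+ j) C j) ℕ.* (j ! ℕ.* (n ℕ.+ j ℕ.∸ j) !))
    ≡⟨ cong toℚ (nCk*k![n∸k]!≡n! (ℕ.m≤n+m j n)) ⟩
  toℚ ((n ℕ.+ j) !)
    ≡⟨ rising-! j n ⟨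
  rising (toℚ j) n * toℚ (j !)
    ∎)
  where open ≡-Reasoning

Δ^-rising : ∀ m → Δ^ m (λ j → rising (toℚ j) m) ≗ const (toℚ (m !))
Δ^-rising zero    j = refl
Δ^-rising (suc m) j = trans (Δ^-*-linear m (toℚ (suc m)) (Δ^-rising m) j) (sym (toℚ-* (suc m) (m !)))

record Quotient (K : ℚ) (d : ℕ) (f : ℚ → ℚ) : Set where
  constructor quotient
  field
    q         : ℕ → ℚ
    degree    : Δ^ d q ≗ const 0ℚ
    remainder : ∀ j → f (toℚ j) ≡ (toℚ j + K) * q j + f (- K)

quotient-cong : ∀ {K d f g} → f ≗ g → Quotient K d f → Quotient K d g
quotient-cong {K} f≗g (quotient q Δ^q≗0 f≡) =
  quotient q Δ^q≗0 λ j → trans (sym (f≗g (toℚ j))) (trans (f≡ j) (cong ((toℚ j + K) * q j +_) (f≗g (- K))))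

quotient-one : ∀ K → Quotient K 0 (const 1ℚ)
quotient-one K = quotient (const 0ℚ) (λ _ → refl) λ j → sym (vanish (toℚ j + K))
  where
  vanish : ∀ x → x * 0ℚ + 1ℚ ≡ 1ℚ
  vanish = solve-∀ ℚ-ring

quotient-*-linear : ∀ {K d f} s → Quotient K d f → Quotient K (suc d) (λ x → f x * (x + s))
quotient-*-linear {K} {d} {f} s (quotient q Δ^q≗0 f≡) =
  quotient (λ j → q j * (toℚ j + s) + f (- K))
           (Δ^-*-linear-+const d s (f (- K)) Δ^q≗0)
           λ j → trans (cong (_* (toℚ j + s)) (f≡ j)) (divide (toℚ j) K (q j) (f (- K)) s)
  where
  divide : ∀ x K q e s → ((x + K) * q + e) * (x + s) ≡ (x + K) * (q * (x + s) + e) + e * (- K + s)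
  divide = solve-∀ ℚ-ring

quotient-rising : ∀ K m → Quotient K m (λ x → rising x m)
quotient-rising K zero    = quotient-one K
quotient-rising K (suc m) = quotient-*-linear (toℚ (suc m)) (quotient-rising K m)

quotient-*-rising : ∀ {K d f} c m → Quotient K d f → Quotient K (m ℕ.+ d) (λ x → f x * rising (x + c) m)
quotient-*-rising {f = f} c zero    quot = quotient-cong (λ x → sym (*-identityʳ (f x))) quot
quotient-*-rising {f = f} c (suc m) quot =
  quotient-cong (λ x → regroup (f x) (rising (x + c) m) x c (toℚ (suc m)))
                (quotient-*-linear (c + toℚ (suc m)) (quotient-*-rising c m quot))
  where
  regroup : ∀ a r x c t → a * r * (x + (c + t)) ≡ a * (r * (x + c + t))
  regroup = solve-∀ ℚ-ring

quotient-degree : ∀ {K d f} → Quotient K d f → Δ^ (suc d) (f ∘ toℚ) ≗ const 0ℚ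
quotient-degree {K} {d} {f} (quotient q Δ^q≗0 f≡) j =
  trans (Δ^-cong (suc d) (λ i → trans (f≡ i) (cong (_+ f (- K)) (*-comm (toℚ i + K) (q i)))) j)
        (Δ^-*-linear-+const d K (f (- K)) Δ^q≗0 j)

recip : ℕ → ℕ → ℚ
recip k j = inv (j ℕ.+ k)

recip-inverse : ∀ a j → (toℚ j + toℚ (suc a)) * recip (suc a) j ≡ 1ℚ
recip-inverse a j = begin
  (toℚ j + toℚ (suc a)) * recip (suc a) j   ≡⟨ cong (_* recip (suc a) j) (toℚ-+ j (suc a)) ⟨
  toℚ (j ℕ.+ suc a) * inv (j ℕ.+ suc a)     ≡⟨ *-comm (toℚ (j ℕ.+ suc a)) (inv (j ℕ.+ suc a)) ⟩
  inv (j ℕ.+ suc a) * toℚ (j ℕ.+ suc a)     ≡⟨ inv-inverseˡ (j ℕ.+ suc a) {{j+suc-a≢0}} ⟩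
  1ℚ                                        ∎
  where
  open ≡-Reasoning
  j+suc-a≢0 : NonZero (j ℕ.+ suc a)
  j+suc-a≢0 = ℕ.>-nonZero (ℕ.≤-trans (ℕ.s≤s ℕ.z≤n) (ℕ.m≤n+m (suc a) j))

toℚ*recip : ∀ a j → toℚ j * recip (suc a) j ≡ 1ℚ - toℚ (suc a) * recip (suc a) j
toℚ*recip a j = trans (shift (toℚ j) (toℚ (suc a)) (recip (suc a) j))
                      (cong (_- toℚ (suc a) * recip (suc a) j) (recip-inverse a j))
  where
  shift : ∀ x K u → x * u ≡ (x + K) * u - K * u
  shift = solve-∀ ℚ-ring

quotient-*-recip : ∀ {a d f} (quot : Quotient (toℚ (suc a)) d f) j →
  f (toℚ j) * recip (suc a) j ≡ Quotient.q quot j + f (- toℚ (suc a)) * recip (suc a) j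
quotient-*-recip {a} {f = f} (quotient q _ f≡) j = begin
  f (toℚ j) * u                              ≡⟨ cong (_* u) (f≡ j) ⟩
  ((toℚ j + toℚ (suc a)) * q j + e) * u      ≡⟨ regroup (toℚ j + toℚ (suc a)) (q j) e u ⟩
  q j * ((toℚ j + toℚ (suc a)) * u) + e * u  ≡⟨ cong (λ x → q j * x + e * u) (recip-inverse a j) ⟩
  q j * 1ℚ + e * u                           ≡⟨ cong (_+ e * u) (*-identityʳ (q j)) ⟩
  q j + e * u                                ∎
  where
  open ≡-Reasoning
  u = recip (suc a) j
  e = f (- toℚ (suc a))
  regroup : ∀ l q e u → (l * q + e) * u ≡ q * (l * u) + e * u
  regroup = solve-∀ ℚ-ring

recip-partialFractions : ∀ {k l} j → 1 ℕ.≤ k → k ℕ.< l →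
  recip k j * recip l j ≡ inv (l ℕ.∸ k) * (recip k j - recip l j)
recip-partialFractions {suc a} {suc c} j _ k<l = begin
  U * V                                 ≡⟨ *-identityˡ (U * V) ⟨
  1ℚ * (U * V)                          ≡⟨ cong (_* (U * V)) W*D≡1 ⟨
  W * toℚ (suc c ℕ.∸ suc a) * (U * V)   ≡⟨ cong (λ d → W * d * (U * V)) (toℚ-∸ (ℕ.<⇒≤ k<l)) ⟩
  W * (L - K) * (U * V)                 ≡⟨ expand W (toℚ j) K L U V ⟩
  W * (U * ((x + L) * V) - V * ((x + K) * U)) ≡⟨ cong₂ (λ p r → W * (U * p - V * r)) (recip-inverse c j) (recip-inverse a j) ⟩
  W * (U * 1ℚ - V * 1ℚ)                 ≡⟨ cong₂ (λ p r → W * (p - r)) (*-identityʳ U) (*-identityʳ V) ⟩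
  W * (U - V)                           ∎
  where
  open ≡-Reasoning
  x = toℚ j
  K = toℚ (suc a)
  L = toℚ (suc c)
  U = recip (suc a) j
  V = recip (suc c) j
  W = inv (suc c ℕ.∸ suc a)
  W*D≡1 : W * toℚ (suc c ℕ.∸ suc a) ≡ 1ℚ
  W*D≡1 = inv-inverseˡ (suc c ℕ.∸ suc a) {{ℕ.>-nonZero (ℕ.m<n⇒0<n∸m k<l)}}
  expand : ∀ W x K L U V → W * (L - K) * (U * V) ≡ W * (U * ((x + L) * V) - V * ((x + K) * U))
  expand = solve-∀ ℚ-ring

j²*recip² : ∀ a j →
  toℚ (j ℕ.* j) * (recip (suc a) j * recip (suc a) j)
  ≡ 1ℚ + - (toℚ (suc a) + toℚ (suc a)) * recip (suc a) j + toℚ (suc a) * toℚ (suc a) * (recip (suc a) j * recip (suc a) j)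
j²*recip² a j = begin
  toℚ (j ℕ.* j) * (U * U)              ≡⟨ cong (_* (U * U)) (toℚ-* j j) ⟩
  toℚ j * toℚ j * (U * U)              ≡⟨ regroup (toℚ j) U U ⟩
  (toℚ j * U) * (toℚ j * U)            ≡⟨ cong₂ _*_ (toℚ*recip a j) (toℚ*recip a j) ⟩
  (1ℚ - K * U) * (1ℚ - K * U)          ≡⟨ expand K U ⟩
  1ℚ + - (K + K) * U + K * K * (U * U) ∎
  where
  open ≡-Reasoning
  K = toℚ (suc a)
  U = recip (suc a) j
  regroup : ∀ x u v → x * x * (u * v) ≡ (x * u) * (x * v)
  regroup = solve-∀ ℚ-ring
  expand : ∀ K u → (1ℚ - K * u) * (1ℚ - K * u) ≡ 1ℚ + - (K + K) * u + K * K * (u * u)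
  expand = solve-∀ ℚ-ring

j²*recip*recip : ∀ {k l} j → 1 ℕ.≤ k → k ℕ.< l →
  toℚ (j ℕ.* j) * (recip k j * recip l j)
  ≡ 1ℚ + (toℚ k * toℚ l * inv (l ℕ.∸ k) - toℚ k) * recip k j
       + (- toℚ l - toℚ k * toℚ l * inv (l ℕ.∸ k)) * recip l j
j²*recip*recip {suc a} {suc c} j 1≤k k<l = begin
  toℚ (j ℕ.* j) * (U * V)                      ≡⟨ cong (_* (U * V)) (toℚ-* j j) ⟩
  toℚ j * toℚ j * (U * V)                      ≡⟨ regroup (toℚ j) U V ⟩
  (toℚ j * U) * (toℚ j * V)                    ≡⟨ cong₂ _*_ (toℚ*recip a j) (toℚ*recip c j) ⟩
  (1ℚ - K * U) * (1ℚ - L * V)                  ≡⟨ expand K L U V ⟩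
  1ℚ - K * U - L * V + K * L * (U * V)
    ≡⟨ cong (λ p → 1ℚ - K * U - L * V + K * L * p) (recip-partialFractions j 1≤k k<l) ⟩
  1ℚ - K * U - L * V + K * L * (W * (U - V))   ≡⟨ collect K L W U V ⟩
  1ℚ + (K * L * W - K) * U + (- L - K * L * W) * V ∎
  where
  open ≡-Reasoning
  K = toℚ (suc a)
  L = toℚ (suc c)
  U = recip (suc a) j
  V = recip (suc c) j
  W = inv (suc c ℕ.∸ suc a)
  regroup : ∀ x u v → x * x * (u * v) ≡ (x * u) * (x * v)
  regroup = solve-∀ ℚ-ring
  expand : ∀ K L u v → (1ℚ - K * u) * (1ℚ - L * v) ≡ 1ℚ - K * u - L * v + K * L * (u * v)
  expand = solve-∀ ℚ-ring
  collect : ∀ K L W u v → 1ℚ - K * u - L * v + K * L * (W * (u - v)) ≡ 1ℚ + (K * L * W - K) * u + (- L - K * L * W) * v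
  collect = solve-∀ ℚ-ring

altSum-recip : ∀ n a → altSum n (recip (suc a)) * toℚ ((n ℕ.+ suc a) !) ≡ toℚ (n ! ℕ.* a !)
altSum-recip zero a = begin
  1ℚ * inv (suc a) * toℚ (suc a !)         ≡⟨ cong (_* toℚ (suc a !)) (*-identityˡ (inv (suc a))) ⟩
  inv (suc a) * toℚ (suc a ℕ.* a !)        ≡⟨ cong (inv (suc a) *_) (toℚ-* (suc a) (a !)) ⟩
  inv (suc a) * (toℚ (suc a) * toℚ (a !))  ≡⟨ inv-cancelˡ (suc a) (toℚ (a !)) ⟩
  toℚ (a !)                                ≡⟨ cong toℚ (ℕ.*-identityˡ (a !)) ⟨
  toℚ (1 ℕ.* a !)                          ∎
  where open ≡-Reasoning
altSum-recip (suc n) a = begin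
  altSum (suc n) (recip (suc a)) * toℚ (suc N !)
    ≡⟨ cong (_* toℚ (suc N !)) (trans (altSum-suc n (recip (suc a))) (cong (λ x → P - x) shift)) ⟩
  (P - R) * toℚ (suc N !)
    ≡⟨ distrib P R (toℚ (suc N !)) ⟩
  P * toℚ (suc N !) - R * toℚ (suc N !)
    ≡⟨ cong₂ _-_ IH₁ IH₂ ⟩
  toℚ (n ! ℕ.* a !) * toℚ (suc N) - toℚ (n ! ℕ.* suc a !)
    ≡⟨ cong (_- toℚ (n ! ℕ.* suc a !)) split ⟩
  toℚ (n ! ℕ.* suc a !) + toℚ (suc n ! ℕ.* a !) - toℚ (n ! ℕ.* suc a !)
    ≡⟨ cancel (toℚ (n ! ℕ.* suc a !)) (toℚ (suc n ! ℕ.* a !)) ⟩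
  toℚ (suc n ! ℕ.* a !)
    ∎
  where
  open ≡-Reasoning
  N = n ℕ.+ suc a
  P = altSum n (recip (suc a))
  R = altSum n (recip (suc (suc a)))
  distrib : ∀ p r f → (p - r) * f ≡ p * f - r * f
  distrib = solve-∀ ℚ-ring
  swap : ∀ p s f → p * (s * f) ≡ p * f * s
  swap = solve-∀ ℚ-ring
  cancel : ∀ x y → x + y - x ≡ y
  cancel = solve-∀ ℚ-ring
  identity : ∀ f g n a → f ℕ.* g ℕ.* suc (n ℕ.+ suc a) ≡ f ℕ.* (suc a ℕ.* g) ℕ.+ suc n ℕ.* f ℕ.* g
  identity = ℕ-Solver.solve-∀
  shift : altSum n (recip (suc a) ∘ suc) ≡ R
  shift = altSum-cong n (λ j → cong inv (sym (ℕ.+-suc j (suc a))))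
  IH₁ : P * toℚ (suc N !) ≡ toℚ (n ! ℕ.* a !) * toℚ (suc N)
  IH₁ = trans (cong (P *_) (toℚ-* (suc N) (N !)))
              (trans (swap P (toℚ (suc N)) (toℚ (N !))) (cong (_* toℚ (suc N)) (altSum-recip n a)))
  IH₂ : R * toℚ (suc N !) ≡ toℚ (n ! ℕ.* suc a !)
  IH₂ = trans (cong (λ m → R * toℚ (m !)) (sym (ℕ.+-suc n (suc a)))) (altSum-recip n (suc a))
  split : toℚ (n ! ℕ.* a !) * toℚ (suc N) ≡ toℚ (n ! ℕ.* suc a !) + toℚ (suc n ! ℕ.* a !)
  split = trans (sym (toℚ-* (n ! ℕ.* a !) (suc N)))
                (trans (cong toℚ (identity (n !) (a !) n a)) (toℚ-+ (n ! ℕ.* suc a !) (suc n ! ℕ.* a !)))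

binomUp : ℕ → ℕ → ℚ
binomUp n j = toℚ ((n ℕ.+ j) C j)

binomSum : ℕ → (ℕ → ℚ) → ℚ
binomSum n f = altSum n (λ j → binomUp n j * f j)

binomSum-cong : ∀ n {f g} → f ≗ g → binomSum n f ≡ binomSum n g
binomSum-cong n f≗g = altSum-cong n (λ j → cong (binomUp n j *_) (f≗g j))

binomSum-+ : ∀ n f g → binomSum n (λ j → f j + g j) ≡ binomSum n f + binomSum n g
binomSum-+ n f g = trans (altSum-cong n (λ j → *-distribˡ-+ (binomUp n j) (f j) (g j))) (altSum-+ n _ _)

binomSum-* : ∀ n c f → binomSum n (λ j → c * f j) ≡ c * binomSum n f
binomSum-* n c f = trans (altSum-cong n (λ j → swap (binomUp n j) c (f j))) (altSum-* n c _)
  where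
  swap : ∀ b c x → b * (c * x) ≡ c * (b * x)
  swap = solve-∀ ℚ-ring

binomUp≡inv*rising : ∀ n j → binomUp n j ≡ inv (n !) * rising (toℚ j) n
binomUp≡inv*rising n j = *-toℚ≡⇒≡inv* (n !) {{n ℕ.!≢0}} (binomial-rising n j)

Δ^-binomUp : ∀ n → Δ^ n (binomUp n) ≗ const 1ℚ
Δ^-binomUp n j = begin
  Δ^ n (binomUp n) j                                ≡⟨ Δ^-cong n (binomUp≡inv*rising n) j ⟩
  Δ^ n (λ i → inv (n !) * rising (toℚ i) n) j       ≡⟨ Δ^-* n (inv (n !)) (λ i → rising (toℚ i) n) j ⟩
  inv (n !) * Δ^ n (λ i → rising (toℚ i) n) j       ≡⟨ cong (inv (n !) *_) (Δ^-rising n j) ⟩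
  inv (n !) * toℚ (n !)                             ≡⟨ inv-inverseˡ (n !) {{n ℕ.!≢0}} ⟩
  1ℚ                                                ∎
  where open ≡-Reasoning

binomSum-one : ∀ n → binomSum n (const 1ℚ) ≡ sgn n
binomSum-one n = begin
  binomSum n (const 1ℚ)   ≡⟨ altSum-cong n (λ j → *-identityʳ (binomUp n j)) ⟩
  altSum n (binomUp n)    ≡⟨ altSum-poly n (Δ^-binomUp n) ⟩
  sgn n * 1ℚ              ≡⟨ *-identityʳ (sgn n) ⟩
  sgn n                   ∎
  where open ≡-Reasoning

binomSum-affine : ∀ n α β g h →
  binomSum n (λ j → 1ℚ + α * g j + β * h j) ≡ sgn n + α * binomSum n g + β * binomSum n h
binomSum-affine n α β g h = begin
  binomSum n (λ j → 1ℚ + α * g j + β * h j)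
    ≡⟨ binomSum-+ n (λ j → 1ℚ + α * g j) (λ j → β * h j) ⟩
  binomSum n (λ j → 1ℚ + α * g j) + binomSum n (λ j → β * h j)
    ≡⟨ cong₂ _+_ (binomSum-+ n (const 1ℚ) (λ j → α * g j)) (binomSum-* n β h) ⟩
  binomSum n (const 1ℚ) + binomSum n (λ j → α * g j) + β * binomSum n h
    ≡⟨ cong₂ (λ x y → x + y + β * binomSum n h) (binomSum-one n) (binomSum-* n α g) ⟩
  sgn n + α * binomSum n g + β * binomSum n h
    ∎
  where open ≡-Reasoning

risingSkip : ℕ → ℕ → ℚ → ℚ
risingSkip a b x = rising x a * rising (x + toℚ (suc a)) b

binomUp-factor : ∀ a b j →
  binomUp (suc a ℕ.+ b) j ≡ inv ((suc a ℕ.+ b) !) * ((toℚ j + toℚ (suc a)) * risingSkip a b (toℚ j))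
binomUp-factor a b j = *-toℚ≡⇒≡inv* ((suc a ℕ.+ b) !) {{(suc a ℕ.+ b) ℕ.!≢0}} (begin
  binomUp (suc a ℕ.+ b) j * toℚ ((suc a ℕ.+ b) !)
    ≡⟨ binomial-rising (suc a ℕ.+ b) j ⟩
  rising (toℚ j) (suc a ℕ.+ b)
    ≡⟨ rising-+ (toℚ j) (suc a) b ⟩
  rising (toℚ j) a * (toℚ j + toℚ (suc a)) * rising (toℚ j + toℚ (suc a)) b
    ≡⟨ swap (rising (toℚ j) a) (toℚ j + toℚ (suc a)) (rising (toℚ j + toℚ (suc a)) b) ⟩
  (toℚ j + toℚ (suc a)) * risingSkip a b (toℚ j)
    ∎)
  where
  open ≡-Reasoning
  swap : ∀ r l s → r * l * s ≡ l * (r * s)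
  swap = solve-∀ ℚ-ring

binomUp-recip : ∀ a b j →
  binomUp (suc a ℕ.+ b) j * recip (suc a) j ≡ inv ((suc a ℕ.+ b) !) * risingSkip a b (toℚ j)
binomUp-recip a b j = begin
  binomUp (suc a ℕ.+ b) j * recip (suc a) j
    ≡⟨ cong (_* recip (suc a) j) (binomUp-factor a b j) ⟩
  inv ((suc a ℕ.+ b) !) * ((toℚ j + toℚ (suc a)) * risingSkip a b (toℚ j)) * recip (suc a) j
    ≡⟨ regroup (inv ((suc a ℕ.+ b) !)) (toℚ j + toℚ (suc a)) (risingSkip a b (toℚ j)) (recip (suc a) j) ⟩
  inv ((suc a ℕ.+ b) !) * risingSkip a b (toℚ j) * ((toℚ j + toℚ (suc a)) * recip (suc a) j)
    ≡⟨ cong (inv ((suc a ℕ.+ b) !) * risingSkip a b (toℚ j) *_) (recip-inverse a j) ⟩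
  inv ((suc a ℕ.+ b) !) * risingSkip a b (toℚ j) * 1ℚ
    ≡⟨ *-identityʳ _ ⟩
  inv ((suc a ℕ.+ b) !) * risingSkip a b (toℚ j)
    ∎
  where
  open ≡-Reasoning
  regroup : ∀ i l r u → i * (l * r) * u ≡ i * r * (l * u)
  regroup = solve-∀ ℚ-ring

quotient-risingSkip : ∀ a b → Quotient (toℚ (suc a)) (b ℕ.+ a) (risingSkip a b)
quotient-risingSkip a b = quotient-*-rising (toℚ (suc a)) b (quotient-rising (toℚ (suc a)) a)

risingSkip-at-gap : ∀ a b → risingSkip a b (- toℚ (suc a)) ≡ sgn a * toℚ (a !) * toℚ (b !)
risingSkip-at-gap a b =
  cong₂ _*_ (rising-neg a) (trans (cong (λ x → rising x b) (+-inverseˡ (toℚ (suc a)))) (rising-zero b))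

binomSum-recip : ∀ {n k} → 1 ℕ.≤ k → k ℕ.≤ n → binomSum n (recip k) ≡ 0ℚ
binomSum-recip {n} {suc a} _ k≤n with ℕ.m≤n⇒∃[o]m+o≡n k≤n
... | b , refl = begin
  binomSum n (recip (suc a))                            ≡⟨ altSum-cong n (binomUp-recip a b) ⟩
  altSum n (λ j → inv (n !) * risingSkip a b (toℚ j))   ≡⟨ altSum-* n (inv (n !)) (risingSkip a b ∘ toℚ) ⟩
  inv (n !) * altSum n (risingSkip a b ∘ toℚ)           ≡⟨ cong (inv (n !) *_) (altSum-poly n {risingSkip a b ∘ toℚ} degree) ⟩
  inv (n !) * (sgn n * 0ℚ)                              ≡⟨ vanish (inv (n !)) (sgn n) ⟩
  0ℚ                                                    ∎
  where
  open ≡-Reasoning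
  degree : Δ^ n (risingSkip a b ∘ toℚ) ≗ const 0ℚ
  degree = subst (λ d → Δ^ (suc d) (risingSkip a b ∘ toℚ) ≗ const 0ℚ) (ℕ.+-comm b a)
                 (quotient-degree (quotient-risingSkip a b))
  vanish : ∀ x s → x * (s * 0ℚ) ≡ 0ℚ
  vanish = solve-∀ ℚ-ring

binomSum-recip²≡altSum-recip : ∀ a b →
  binomSum (suc a ℕ.+ b) (λ j → recip (suc a) j * recip (suc a) j)
  ≡ inv ((suc a ℕ.+ b) !) * (sgn a * toℚ (a !) * toℚ (b !)) * altSum (suc a ℕ.+ b) (recip (suc a))
binomSum-recip²≡altSum-recip a b = begin
  binomSum n (λ j → u j * u j)
    ≡⟨ altSum-cong n pointwise ⟩
  altSum n (λ j → i * q j + i * e * u j)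
    ≡⟨ trans (altSum-+ n (λ j → i * q j) (λ j → i * e * u j)) (cong₂ _+_ (altSum-* n i q) (altSum-* n (i * e) u)) ⟩
  i * altSum n q + i * e * altSum n u
    ≡⟨ cong (λ x → i * x + i * e * altSum n u) (altSum-poly n {q} degree-q) ⟩
  i * (sgn n * 0ℚ) + i * e * altSum n u
    ≡⟨ vanish i (sgn n) (i * e * altSum n u) ⟩
  i * e * altSum n u
    ≡⟨ cong (λ x → i * x * altSum n u) (risingSkip-at-gap a b) ⟩
  i * (sgn a * toℚ (a !) * toℚ (b !)) * altSum n u
    ∎
  where
  open ≡-Reasoning
  open Quotient (quotient-risingSkip a b) using (q; degree)
  n = suc a ℕ.+ b
  u = recip (suc a)
  i = inv (n !)
  e = risingSkip a b (- toℚ (suc a))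
  degree-q : Δ^ n q ≗ const 0ℚ
  degree-q = subst (λ d → Δ^ (suc d) q ≗ const 0ℚ) (ℕ.+-comm b a) (Δ^-raise (b ℕ.+ a) {q} degree)
  vanish : ∀ x s y → x * (s * 0ℚ) + y ≡ y
  vanish = solve-∀ ℚ-ring
  distrib : ∀ i x e u → i * (x + e * u) ≡ i * x + i * e * u
  distrib = solve-∀ ℚ-ring
  pointwise : ∀ j → binomUp n j * (u j * u j) ≡ i * q j + i * e * u j
  pointwise j = begin
    binomUp n j * (u j * u j)             ≡⟨ *-assoc (binomUp n j) (u j) (u j) ⟨
    binomUp n j * u j * u j               ≡⟨ cong (_* u j) (binomUp-recip a b j) ⟩
    i * risingSkip a b (toℚ j) * u j      ≡⟨ *-assoc i (risingSkip a b (toℚ j)) (u j) ⟩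
    i * (risingSkip a b (toℚ j) * u j)    ≡⟨ cong (i *_) (quotient-*-recip (quotient-risingSkip a b) j) ⟩
    i * (q j + e * u j)                   ≡⟨ distrib i (q j) e (u j) ⟩
    i * q j + i * e * u j                 ∎

invBinomTerm : ℕ → ℕ → ℚ
invBinomTerm n k = inv ((n ℕ.+ k) C k) * inv (n C k) * sgn k

invBinomTerm-! : ∀ {n k} → k ℕ.≤ n →
  invBinomTerm n k * toℚ ((n ℕ.+ k) !) ≡ sgn k * (toℚ (k !) * toℚ (k !) * toℚ ((n ℕ.∸ k) !))
invBinomTerm-! {n} {k} k≤n = begin
  inv ((n ℕ.+ k) C k) * inv (n C k) * sgn k * toℚ ((n ℕ.+ k) !)
    ≡⟨ regroup (inv ((n ℕ.+ k) C k)) (inv (n C k)) (sgn k) (toℚ ((n ℕ.+ k) !)) ⟩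
  sgn k * (inv (n C k) * (inv ((n ℕ.+ k) C k) * toℚ ((n ℕ.+ k) !)))
    ≡⟨ cong (λ x → sgn k * (inv (n C k) * x)) (inv-nCk (ℕ.m≤n+m k n)) ⟩
  sgn k * (inv (n C k) * toℚ (k ! ℕ.* (n ℕ.+ k ℕ.∸ k) !))
    ≡⟨ cong (λ m → sgn k * (inv (n C k) * toℚ (k ! ℕ.* m !))) (ℕ.m+n∸n≡m n k) ⟩
  sgn k * (inv (n C k) * toℚ (k ! ℕ.* n !))
    ≡⟨ cong (λ x → sgn k * (inv (n C k) * x)) (toℚ-* (k !) (n !)) ⟩
  sgn k * (inv (n C k) * (toℚ (k !) * toℚ (n !)))
    ≡⟨ cong (sgn k *_) (swap (inv (n C k)) (toℚ (k !)) (toℚ (n !))) ⟩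
  sgn k * (toℚ (k !) * (inv (n C k) * toℚ (n !)))
    ≡⟨ cong (λ x → sgn k * (toℚ (k !) * x)) (trans (inv-nCk k≤n) (toℚ-* (k !) ((n ℕ.∸ k) !))) ⟩
  sgn k * (toℚ (k !) * (toℚ (k !) * toℚ ((n ℕ.∸ k) !)))
    ≡⟨ cong (sgn k *_) (*-assoc (toℚ (k !)) (toℚ (k !)) (toℚ ((n ℕ.∸ k) !))) ⟨
  sgn k * (toℚ (k !) * toℚ (k !) * toℚ ((n ℕ.∸ k) !))
    ∎
  where
  open ≡-Reasoning
  regroup : ∀ c₁ c₂ s f → c₁ * c₂ * s * f ≡ s * (c₂ * (c₁ * f))
  regroup = solve-∀ ℚ-ring
  swap : ∀ c x y → c * (x * y) ≡ x * (c * y)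
  swap = solve-∀ ℚ-ring

binomSum-recip² : ∀ {n k} → 1 ℕ.≤ k → k ℕ.≤ n →
  toℚ (k ℕ.* k) * binomSum n (λ j → recip k j * recip k j) ≡ - invBinomTerm n k
binomSum-recip² {n} {suc a} _ k≤n with ℕ.m≤n⇒∃[o]m+o≡n k≤n
... | b , refl = *-cancelʳ-toℚ ((n ℕ.+ k) !) {{(n ℕ.+ k) ℕ.!≢0}} (begin
  toℚ (k ℕ.* k) * binomSum n (λ j → u j * u j) * F
    ≡⟨ cong (λ x → toℚ (k ℕ.* k) * x * F) (binomSum-recip²≡altSum-recip a b) ⟩
  toℚ (k ℕ.* k) * (inv (n !) * e * altSum n u) * F
    ≡⟨ regroup (toℚ (k ℕ.* k)) (inv (n !)) e (altSum n u) F ⟩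
  toℚ (k ℕ.* k) * e * (inv (n !) * (altSum n u * F))
    ≡⟨ cong (λ x → toℚ (k ℕ.* k) * e * (inv (n !) * x)) (trans (altSum-recip n a) (toℚ-* (n !) (a !))) ⟩
  toℚ (k ℕ.* k) * e * (inv (n !) * (toℚ (n !) * toℚ (a !)))
    ≡⟨ cong₂ (λ x y → x * e * y) (toℚ-* k k) (inv-cancelˡ (n !) {{n ℕ.!≢0}} (toℚ (a !))) ⟩
  toℚ k * toℚ k * (sgn a * toℚ (a !) * toℚ (b !)) * toℚ (a !)
    ≡⟨ collect (toℚ k) (sgn a) (toℚ (a !)) (toℚ (b !)) ⟩
  - (- sgn a * (toℚ k * toℚ (a !) * (toℚ k * toℚ (a !)) * toℚ (b !)))
    ≡⟨ cong (λ x → - (- sgn a * (x * x * toℚ (b !)))) (toℚ-* k (a !)) ⟨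
  - (sgn k * (toℚ (k !) * toℚ (k !) * toℚ (b !)))
    ≡⟨ cong (λ m → - (sgn k * (toℚ (k !) * toℚ (k !) * toℚ (m !)))) (ℕ.m+n∸m≡n k b) ⟨
  - (sgn k * (toℚ (k !) * toℚ (k !) * toℚ ((n ℕ.∸ k) !)))
    ≡⟨ cong -_ (invBinomTerm-! (ℕ.m≤m+n k b)) ⟨
  - (invBinomTerm n k * F)
    ≡⟨ neg-distribˡ-* (invBinomTerm n k) F ⟩
  - invBinomTerm n k * F
    ∎)
  where
  open ≡-Reasoning
  k = suc a
  F = toℚ ((n ℕ.+ k) !)
  u = recip k
  e = sgn a * toℚ (a !) * toℚ (b !)
  regroup : ∀ c i e s f → c * (i * e * s) * f ≡ c * e * (i * (s * f))
  regroup = solve-∀ ℚ-ring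
  collect : ∀ x s y z → x * x * (s * y * z) * y ≡ - (- s * (x * y * (x * y) * z))
  collect = solve-∀ ℚ-ring

weightedSum : ℕ → (ℕ → ℚ) → ℚ
weightedSum n f = binomSum n (λ j → toℚ (j ℕ.* j) * f j)

weightedSum-cong : ∀ n {f g} → f ≗ g → weightedSum n f ≡ weightedSum n g
weightedSum-cong n f≗g = binomSum-cong n (λ j → cong (toℚ (j ℕ.* j) *_) (f≗g j))

weightedSum-+ : ∀ n f g → weightedSum n (λ j → f j + g j) ≡ weightedSum n f + weightedSum n g
weightedSum-+ n f g = trans (binomSum-cong n (λ j → *-distribˡ-+ (toℚ (j ℕ.* j)) (f j) (g j))) (binomSum-+ n _ _)

weightedSum-* : ∀ n c f → weightedSum n (λ j → c * f j) ≡ c * weightedSum n f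
weightedSum-* n c f = trans (binomSum-cong n (λ j → swap (toℚ (j ℕ.* j)) c (f j))) (binomSum-* n c _)
  where
  swap : ∀ s c x → s * (c * x) ≡ c * (s * x)
  swap = solve-∀ ℚ-ring

weightedSum-recip² : ∀ {n k} → 1 ℕ.≤ k → k ℕ.≤ n →
  weightedSum n (λ j → recip k j * recip k j) ≡ sgn n - invBinomTerm n k
weightedSum-recip² {n} {suc a} 1≤k k≤n = begin
  weightedSum n (λ j → U j * U j)
    ≡⟨ binomSum-cong n (j²*recip² a) ⟩
  binomSum n (λ j → 1ℚ + - (K + K) * U j + K * K * (U j * U j))
    ≡⟨ binomSum-affine n (- (K + K)) (K * K) U (λ j → U j * U j) ⟩
  sgn n + - (K + K) * binomSum n U + K * K * binomSum n (λ j → U j * U j)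
    ≡⟨ cong₂ (λ x y → sgn n + - (K + K) * x + y) (binomSum-recip 1≤k k≤n)
             (trans (cong (_* binomSum n (λ j → U j * U j)) (sym (toℚ-* (suc a) (suc a)))) (binomSum-recip² 1≤k k≤n)) ⟩
  sgn n + - (K + K) * 0ℚ + - invBinomTerm n (suc a)
    ≡⟨ simplify (sgn n) K (invBinomTerm n (suc a)) ⟩
  sgn n - invBinomTerm n (suc a)
    ∎
  where
  open ≡-Reasoning
  K = toℚ (suc a)
  U = recip (suc a)
  simplify : ∀ s K e → s + - (K + K) * 0ℚ + - e ≡ s - e
  simplify = solve-∀ ℚ-ring

weightedSum-recip-recip : ∀ {n k l} → 1 ℕ.≤ k → k ℕ.< l → l ℕ.≤ n →
  weightedSum n (λ j → recip k j * recip l j) ≡ sgn n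
weightedSum-recip-recip {n} {k} {l} 1≤k k<l l≤n = begin
  weightedSum n (λ j → recip k j * recip l j)
    ≡⟨ binomSum-cong n (λ j → j²*recip*recip j 1≤k k<l) ⟩
  binomSum n (λ j → 1ℚ + α * recip k j + β * recip l j)
    ≡⟨ binomSum-affine n α β (recip k) (recip l) ⟩
  sgn n + α * binomSum n (recip k) + β * binomSum n (recip l)
    ≡⟨ cong₂ (λ x y → sgn n + α * x + β * y)
             (binomSum-recip 1≤k (ℕ.≤-trans k≤l l≤n)) (binomSum-recip (ℕ.≤-trans 1≤k k≤l) l≤n) ⟩
  sgn n + α * 0ℚ + β * 0ℚ
    ≡⟨ simplify (sgn n) α β ⟩
  sgn n
    ∎
  where
  open ≡-Reasoning
  α = toℚ k * toℚ l * inv (l ℕ.∸ k) - toℚ k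
  β = - toℚ l - toℚ k * toℚ l * inv (l ℕ.∸ k)
  k≤l = ℕ.<⇒≤ k<l
  simplify : ∀ s α β → s + α * 0ℚ + β * 0ℚ ≡ s
  simplify = solve-∀ ℚ-ring

recipSum : ℕ → ℕ → ℚ
recipSum m j = sum1 m (λ k → recip k j)

recip²Sum : ℕ → ℕ → ℚ
recip²Sum m j = sum1 m (λ k → recip k j * recip k j)

weightedSum-recipSum-recip : ∀ {n m l} → m ℕ.< l → l ℕ.≤ n →
  weightedSum n (λ j → recipSum m j * recip l j) ≡ toℚ m * sgn n
weightedSum-recipSum-recip {n} {zero} {l} _ _ = begin
  weightedSum n (λ j → 0ℚ * recip l j)   ≡⟨ weightedSum-* n 0ℚ (recip l) ⟩
  0ℚ * weightedSum n (recip l)           ≡⟨ *-zeroˡ (weightedSum n (recip l)) ⟩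
  0ℚ                                     ≡⟨ *-zeroˡ (sgn n) ⟨
  0ℚ * sgn n                             ∎
  where open ≡-Reasoning
weightedSum-recipSum-recip {n} {suc m} {l} m<l l≤n = begin
  weightedSum n (λ j → (recipSum m j + recip (suc m) j) * recip l j)
    ≡⟨ weightedSum-cong n (λ j → *-distribʳ-+ (recip l j) (recipSum m j) (recip (suc m) j)) ⟩
  weightedSum n (λ j → recipSum m j * recip l j + recip (suc m) j * recip l j)
    ≡⟨ weightedSum-+ n (λ j → recipSum m j * recip l j) (λ j → recip (suc m) j * recip l j) ⟩
  weightedSum n (λ j → recipSum m j * recip l j) + weightedSum n (λ j → recip (suc m) j * recip l j)
    ≡⟨ cong₂ _+_ (weightedSum-recipSum-recip (ℕ.<-trans (ℕ.n<1+n m) m<l) l≤n)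
                 (weightedSum-recip-recip (ℕ.s≤s ℕ.z≤n) m<l l≤n) ⟩
  toℚ m * sgn n + sgn n
    ≡⟨ collect (toℚ m) (sgn n) ⟩
  (1ℚ + toℚ m) * sgn n
    ≡⟨ cong (_* sgn n) (toℚ-+ 1 m) ⟨
  toℚ (suc m) * sgn n
    ∎
  where
  open ≡-Reasoning
  collect : ∀ m s → m * s + s ≡ (1ℚ + m) * s
  collect = solve-∀ ℚ-ring

harmonicCombination : ℕ → ℕ → ℚ
harmonicCombination m j = toℚ 2 * (recipSum m j * recipSum m j) - recip²Sum m j

harmonicCombination-suc : ∀ m j → harmonicCombination (suc m) j
  ≡ harmonicCombination m j + (toℚ 4 * (recipSum m j * recip (suc m) j) + recip (suc m) j * recip (suc m) j)
harmonicCombination-suc m j = expand (recipSum m j) (recip²Sum m j) (recip (suc m) j)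
  where
  expand : ∀ a b u → toℚ 2 * ((a + u) * (a + u)) - (b + u * u) ≡ toℚ 2 * (a * a) - b + (toℚ 4 * (a * u) + u * u)
  expand = solve-∀ ℚ-ring

weightedSum-harmonicCombination : ∀ {n m} → m ℕ.≤ n →
  weightedSum n (harmonicCombination m) ≡ (toℚ 2 * (toℚ m * toℚ m) - toℚ m) * sgn n - sum1 m (invBinomTerm n)
weightedSum-harmonicCombination {n} {zero} _ = begin
  weightedSum n (λ j → 0ℚ * 0ℚ)           ≡⟨ weightedSum-* n 0ℚ (const 0ℚ) ⟩
  0ℚ * weightedSum n (const 0ℚ)           ≡⟨ vanish (weightedSum n (const 0ℚ)) (sgn n) ⟩
  (toℚ 2 * (0ℚ * 0ℚ) - 0ℚ) * sgn n - 0ℚ  ∎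
  where
  open ≡-Reasoning
  vanish : ∀ w s → 0ℚ * w ≡ (toℚ 2 * (0ℚ * 0ℚ) - 0ℚ) * s - 0ℚ
  vanish = solve-∀ ℚ-ring
weightedSum-harmonicCombination {n} {suc m} m<n = begin
  weightedSum n (harmonicCombination (suc m))
    ≡⟨ weightedSum-cong n (harmonicCombination-suc m) ⟩
  weightedSum n (λ j → harmonicCombination m j + (toℚ 4 * (recipSum m j * U j) + U j * U j))
    ≡⟨ trans (weightedSum-+ n (harmonicCombination m) _) (cong (weightedSum n (harmonicCombination m) +_)
        (trans (weightedSum-+ n _ (λ j → U j * U j))
               (cong (_+ weightedSum n (λ j → U j * U j)) (weightedSum-* n (toℚ 4) _)))) ⟩
  weightedSum n (harmonicCombination m)
    + (toℚ 4 * weightedSum n (λ j → recipSum m j * U j) + weightedSum n (λ j → U j * U j))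
    ≡⟨ cong₂ _+_ (weightedSum-harmonicCombination (ℕ.<⇒≤ m<n))
                 (cong₂ (λ x y → toℚ 4 * x + y)
                        (weightedSum-recipSum-recip (ℕ.n<1+n m) m<n) (weightedSum-recip² (ℕ.s≤s ℕ.z≤n) m<n)) ⟩
  (toℚ 2 * (toℚ m * toℚ m) - toℚ m) * sgn n - E + (toℚ 4 * (toℚ m * sgn n) + (sgn n - e))
    ≡⟨ collect (toℚ m) (sgn n) E e ⟩
  (toℚ 2 * ((1ℚ + toℚ m) * (1ℚ + toℚ m)) - (1ℚ + toℚ m)) * sgn n - (E + e)
    ≡⟨ cong (λ x → (toℚ 2 * (x * x) - x) * sgn n - (E + e)) (toℚ-+ 1 m) ⟨
  (toℚ 2 * (toℚ (suc m) * toℚ (suc m)) - toℚ (suc m)) * sgn n - sum1 (suc m) (invBinomTerm n)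
    ∎
  where
  open ≡-Reasoning
  U = recip (suc m)
  E = sum1 m (invBinomTerm n)
  e = invBinomTerm n (suc m)
  collect : ∀ m s E e → (toℚ 2 * (m * m) - m) * s - E + (toℚ 4 * (m * s) + (s - e))
                        ≡ (toℚ 2 * ((1ℚ + m) * (1ℚ + m)) - (1ℚ + m)) * s - (E + e)
  collect = solve-∀ ℚ-ring

H1-difference : ∀ n j → H 1 (n ℕ.+ j) - H 1 j ≡ recipSum n j
H1-difference n j =
  trans (sum1-difference n j (λ k → inv (k ℕ.^ 1))) (sum1-cong n (λ k → cong inv (ℕ.*-identityʳ (j ℕ.+ k))))

H2-difference : ∀ n j → H 2 (n ℕ.+ j) - H 2 j ≡ recip²Sum n j
H2-difference n j =
  trans (sum1-difference n j (λ k → inv (k ℕ.^ 2))) (sum1-cong n (λ k → inv-^2 (j ℕ.+ k)))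

weightedSum-expand : ∀ n f →
  weightedSum n f ≡ sum1 n (λ j → sgn j * toℚ (n C j) * (binomUp n j * (toℚ (j ℕ.* j) * f j)))
weightedSum-expand n f = trans (altSum-expand n _) (vanish (binomUp n 0) (f 0) _)
  where
  vanish : ∀ b x S → b * (0ℚ * x) + S ≡ S
  vanish = solve-∀ ℚ-ring

toℚ-n[2n∸1] : ∀ n → toℚ (n ℕ.* (2 ℕ.* n ℕ.∸ 1)) ≡ toℚ 2 * (toℚ n * toℚ n) - toℚ n
toℚ-n[2n∸1] zero    = refl
toℚ-n[2n∸1] (suc m) = begin
  toℚ (n ℕ.* (2 ℕ.* n ℕ.∸ 1))                  ≡⟨ cancel (toℚ (n ℕ.* (2 ℕ.* n ℕ.∸ 1))) (toℚ n) ⟨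
  toℚ (n ℕ.* (2 ℕ.* n ℕ.∸ 1)) + toℚ n - toℚ n  ≡⟨ cong (_- toℚ n) (toℚ-+ (n ℕ.* (2 ℕ.* n ℕ.∸ 1)) n) ⟨
  toℚ (n ℕ.* (2 ℕ.* n ℕ.∸ 1) ℕ.+ n) - toℚ n    ≡⟨ cong (λ x → toℚ x - toℚ n) (identity m) ⟩
  toℚ (2 ℕ.* (n ℕ.* n)) - toℚ n                ≡⟨ cong (_- toℚ n) (trans (toℚ-* 2 (n ℕ.* n)) (cong (toℚ 2 *_) (toℚ-* n n))) ⟩
  toℚ 2 * (toℚ n * toℚ n) - toℚ n              ∎
  where
  open ≡-Reasoning
  n = suc m
  cancel : ∀ x y → x + y - y ≡ x
  cancel = solve-∀ ℚ-ring
  identity : ∀ m → suc m ℕ.* (m ℕ.+ suc (m ℕ.+ 0)) ℕ.+ suc m ≡ 2 ℕ.* (suc m ℕ.* suc m)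
  identity = ℕ-Solver.solve-∀

firstSum≡weightedSum : ∀ n →
  sum1 n (λ j → toℚ ((n ℕ.+ j) C j) * toℚ (n C j) * sgn j * toℚ (j ℕ.* j)
         * (toℚ 2 * ((H 1 (n ℕ.+ j) - H 1 j) * (H 1 (n ℕ.+ j) - H 1 j)) - (H 2 (n ℕ.+ j) - H 2 j)))
  ≡ weightedSum n (harmonicCombination n)
firstSum≡weightedSum n = trans (sum1-cong n summand≡) (sym (weightedSum-expand n (harmonicCombination n)))
  where
  regroup : ∀ b c s w F → b * c * s * w * F ≡ s * c * (b * (w * F))
  regroup = solve-∀ ℚ-ring
  summand≡ : ∀ j →
    toℚ ((n ℕ.+ j) C j) * toℚ (n C j) * sgn j * toℚ (j ℕ.* j)
    * (toℚ 2 * ((H 1 (n ℕ.+ j) - H 1 j) * (H 1 (n ℕ.+ j) - H 1 j)) - (H 2 (n ℕ.+ j) - H 2 j))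
    ≡ sgn j * toℚ (n C j) * (binomUp n j * (toℚ (j ℕ.* j) * harmonicCombination n j))
  summand≡ j = trans (cong₂ (λ A B → toℚ ((n ℕ.+ j) C j) * toℚ (n C j) * sgn j * toℚ (j ℕ.* j) * (toℚ 2 * (A * A) - B))
                            (H1-difference n j) (H2-difference n j))
                     (regroup (binomUp n j) (toℚ (n C j)) (sgn j) (toℚ (j ℕ.* j)) (harmonicCombination n j))

-- The identity also holds for n = 0.
mainTheorem4 : (n : ℕ) → 1 ℕ.≤ n →
    sum1 n (λ j → toℚ ((n ℕ.+ j) C j) * toℚ (n C j) * sgn j * toℚ (j ℕ.* j)
        * (toℚ 2 * ((H 1 (n ℕ.+ j) - H 1 j) * (H 1 (n ℕ.+ j) - H 1 j))
           - (H 2 (n ℕ.+ j) - H 2 j)))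
    + sum1 n (λ j → inv ((n ℕ.+ j) C j) * inv (n C j) * sgn j)
    ≡ toℚ (n ℕ.* (2 ℕ.* n ℕ.∸ 1)) * sgn n
mainTheorem4 n _ = begin
  firstSum + E                                          ≡⟨ cong (_+ E) (firstSum≡weightedSum n) ⟩
  weightedSum n (harmonicCombination n) + E             ≡⟨ cong (_+ E) (weightedSum-harmonicCombination {n} ℕ.≤-refl) ⟩
  (toℚ 2 * (toℚ n * toℚ n) - toℚ n) * sgn n - E + E     ≡⟨ cancel ((toℚ 2 * (toℚ n * toℚ n) - toℚ n) * sgn n) E ⟩
  (toℚ 2 * (toℚ n * toℚ n) - toℚ n) * sgn n             ≡⟨ cong (_* sgn n) (toℚ-n[2n∸1] n) ⟨
  toℚ (n ℕ.* (2 ℕ.* n ℕ.∸ 1)) * sgn n                   ∎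
  where
  open ≡-Reasoning
  firstSum = sum1 n (λ j → toℚ ((n ℕ.+ j) C j) * toℚ (n C j) * sgn j * toℚ (j ℕ.* j)
             * (toℚ 2 * ((H 1 (n ℕ.+ j) - H 1 j) * (H 1 (n ℕ.+ j) - H 1 j)) - (H 2 (n ℕ.+ j) - H 2 j)))
  E = sum1 n (invBinomTerm n)
  cancel : ∀ x y → x - y + y ≡ x
  cancel = solve-∀ ℚ-ring
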